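{- Let $G=(U,V,E)$ be a bipartite graph and let $X \subseteq V$ be such that some minimum vertex cover of $G$ contains $X$. Let $Y \subseteq V$. Then $G \setminus Y$ has a minimum vertex cover that contains $X \setminus Y$.
   Context: $G=(U,V,E)$ denotes a bipartite graph with vertex set $U \cup V$ and every edge having one end in $U$ and the other in $V$. $G \setminus Y$ is the graph obtained by deleting the vertices of $Y$. A minimum vertex cover is a vertex cover of smallest size. -}

module Defs where

open import Data.Nat using (ℕ; _+_; _≤_)
open import Data.Bool using (Bool; true)
open import Data.Fin using (Fin)
open import Data.Fin.Subset using (Subset; _∈_; _∉_; _⊆_; ∣_∣; ∁; _─_; ⊥)
open import Data.Product using (_×_; Σ; _,_)
open import Data.Sum using (_⊎_)
open import Relation.Binary.PropositionalEquality using (_≡_)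

record BipGraph : Set where
  field
    m n : ℕ
    E   : Fin m → Fin n → Bool
open BipGraph public

VSet : BipGraph → Set
VSet G = Subset (m G) × Subset (n G)

-- The induced subgraph G ∖ (DU , DV): vertices are U ∖ DU and V ∖ DV,
-- edges those of G between remaining vertices.
IsVertexCoverDel : (G : BipGraph) → VSet G → VSet G → Set
IsVertexCoverDel G (DU , DV) (A , B) =
  (A ⊆ ∁ DU) × (B ⊆ ∁ DV) ×
  (∀ u v → u ∉ DU → v ∉ DV → E G u v ≡ true → (u ∈ A) ⊎ (v ∈ B))

size : (G : BipGraph) → VSet G → ℕ
size G (A , B) = ∣ A ∣ + ∣ B ∣

IsMinVertexCoverDel : (G : BipGraph) → VSet G → VSet G → Set
IsMinVertexCoverDel G D C =
  IsVertexCoverDel G D C × (∀ C' → IsVertexCoverDel G D C' → size G C ≤ size G C')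

IsMinVertexCover : (G : BipGraph) → VSet G → Set
IsMinVertexCover G = IsMinVertexCoverDel G (⊥ , ⊥)

IsMinVertexCoverMinusV : (G : BipGraph) → Subset (n G) → VSet G → Set
IsMinVertexCoverMinusV G Y = IsMinVertexCoverDel G (⊥ , Y)

-- For vertex covers C = (A , B) and C' = (A' , B') of a bipartite graph, both
-- (A ∩ A' , B ∪ B') and (A ∪ A' , B ∩ B') are vertex covers, and their sizes add up to
-- |C| + |C'|; so if C is minimum, the first one is no larger than C'.  Apply this to a
-- minimum cover C of G with X on its V-side and to the cover of G obtained by adding Y
-- to a minimum cover D of G ∖ Y: the result contains X and has size at most |D| + |Y|,
-- so removing Y from it leaves a cover of G ∖ Y of size at most |D| containing X ∖ Y.
module Submission where

open import Defs
open import Data.Fin.Subset using (Subset; _⊆_; _─_)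
open import Data.Product using (Σ; _×_; _,_; proj₂)

open import Data.Bool using (true)
open import Data.Bool.Properties using () renaming (_≟_ to _≟ᵇ_)
open import Data.Fin using (Fin)
open import Data.Fin.Properties using (all?)
open import Data.Fin.Subset using (_∈_; _∉_; _∩_; _∪_; ∁; ∣_∣; ⊥; inside; outside)
open import Data.Fin.Subset.Properties
open import Data.Nat using (zero; suc; _+_; _≤_; _<_; z≤n)
open import Data.Nat.Properties
open import Algebra.Properties.CommutativeSemigroup +-commutativeSemigroup using (interchange)
open import Data.Product using (∃; proj₁)
open import Data.Sum using (_⊎_; inj₁; inj₂; [_,_]; map₂)
open import Data.Vec using ([]; _∷_)
open import Data.Vec.Base using (here; there)
open import Function using (_∘_; id)
open import Relation.Nullary using (Dec; yes; no)
open import Relation.Nullary.Decidable using (map′; _×-dec_; _⊎-dec_; _→-dec_; ¬?)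
open import Relation.Binary.PropositionalEquality using (_≡_; refl; cong; cong₂; module ≡-Reasoning)

x∈p─q⇒x∉q : ∀ {k} {x : Fin k} (p q : Subset k) → x ∈ p ─ q → x ∉ q
x∈p─q⇒x∉q (inside ∷ p) (outside ∷ q) here ()
x∈p─q⇒x∉q (_ ∷ p) (_ ∷ q) (there x∈p─q) (there x∈q) = x∈p─q⇒x∉q p q x∈p─q x∈q

∣p∩q∣+∣p∪q∣≡∣p∣+∣q∣ : ∀ {k} (p q : Subset k) → ∣ p ∩ q ∣ + ∣ p ∪ q ∣ ≡ ∣ p ∣ + ∣ q ∣
∣p∩q∣+∣p∪q∣≡∣p∣+∣q∣ [] [] = refl
∣p∩q∣+∣p∪q∣≡∣p∣+∣q∣ (outside ∷ p) (outside ∷ q) = ∣p∩q∣+∣p∪q∣≡∣p∣+∣q∣ p q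
∣p∩q∣+∣p∪q∣≡∣p∣+∣q∣ (outside ∷ p) (inside ∷ q) = begin
  ∣ p ∩ q ∣ + suc ∣ p ∪ q ∣ ≡⟨ +-suc ∣ p ∩ q ∣ ∣ p ∪ q ∣ ⟩
  suc (∣ p ∩ q ∣ + ∣ p ∪ q ∣) ≡⟨ cong suc (∣p∩q∣+∣p∪q∣≡∣p∣+∣q∣ p q) ⟩
  suc (∣ p ∣ + ∣ q ∣) ≡⟨ +-suc ∣ p ∣ ∣ q ∣ ⟨
  ∣ p ∣ + suc ∣ q ∣ ∎
  where open ≡-Reasoning
∣p∩q∣+∣p∪q∣≡∣p∣+∣q∣ (inside ∷ p) (outside ∷ q) = begin
  ∣ p ∩ q ∣ + suc ∣ p ∪ q ∣ ≡⟨ +-suc ∣ p ∩ q ∣ ∣ p ∪ q ∣ ⟩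
  suc (∣ p ∩ q ∣ + ∣ p ∪ q ∣) ≡⟨ cong suc (∣p∩q∣+∣p∪q∣≡∣p∣+∣q∣ p q) ⟩
  suc (∣ p ∣ + ∣ q ∣) ∎
  where open ≡-Reasoning
∣p∩q∣+∣p∪q∣≡∣p∣+∣q∣ (inside ∷ p) (inside ∷ q) = cong suc (begin
  ∣ p ∩ q ∣ + suc ∣ p ∪ q ∣ ≡⟨ +-suc ∣ p ∩ q ∣ ∣ p ∪ q ∣ ⟩
  suc (∣ p ∩ q ∣ + ∣ p ∪ q ∣) ≡⟨ cong suc (∣p∩q∣+∣p∪q∣≡∣p∣+∣q∣ p q) ⟩
  suc (∣ p ∣ + ∣ q ∣) ≡⟨ +-suc ∣ p ∣ ∣ q ∣ ⟨
  ∣ p ∣ + suc ∣ q ∣ ∎)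
  where open ≡-Reasoning

∣p∪q∣≤∣p∣+∣q∣ : ∀ {k} (p q : Subset k) → ∣ p ∪ q ∣ ≤ ∣ p ∣ + ∣ q ∣
∣p∪q∣≤∣p∣+∣q∣ p q =
  ≤-trans (m≤n+m ∣ p ∪ q ∣ ∣ p ∩ q ∣) (≤-reflexive (∣p∩q∣+∣p∪q∣≡∣p∣+∣q∣ p q))

∣p─q∣+∣p∩q∣≡∣p∣ : ∀ {k} (p q : Subset k) → ∣ p ─ q ∣ + ∣ p ∩ q ∣ ≡ ∣ p ∣
∣p─q∣+∣p∩q∣≡∣p∣ [] [] = refl
∣p─q∣+∣p∩q∣≡∣p∣ (outside ∷ p) (outside ∷ q) = ∣p─q∣+∣p∩q∣≡∣p∣ p q
∣p─q∣+∣p∩q∣≡∣p∣ (outside ∷ p) (inside ∷ q) = ∣p─q∣+∣p∩q∣≡∣p∣ p q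
∣p─q∣+∣p∩q∣≡∣p∣ (inside ∷ p) (outside ∷ q) = cong suc (∣p─q∣+∣p∩q∣≡∣p∣ p q)
∣p─q∣+∣p∩q∣≡∣p∣ (inside ∷ p) (inside ∷ q) = begin
  ∣ p ─ q ∣ + suc ∣ p ∩ q ∣ ≡⟨ +-suc ∣ p ─ q ∣ ∣ p ∩ q ∣ ⟩
  suc (∣ p ─ q ∣ + ∣ p ∩ q ∣) ≡⟨ cong suc (∣p─q∣+∣p∩q∣≡∣p∣ p q) ⟩
  suc ∣ p ∣ ∎
  where open ≡-Reasoning

q⊆p⇒∣p─q∣+∣q∣≤∣p∣ : ∀ {k} {p q : Subset k} → q ⊆ p → ∣ p ─ q ∣ + ∣ q ∣ ≤ ∣ p ∣
q⊆p⇒∣p─q∣+∣q∣≤∣p∣ {p = p} {q} q⊆p = begin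
  ∣ p ─ q ∣ + ∣ q ∣     ≤⟨ +-monoʳ-≤ ∣ p ─ q ∣ (p⊆q⇒∣p∣≤∣q∣ (λ x∈q → x∈p∩q⁺ (q⊆p x∈q , x∈q))) ⟩
  ∣ p ─ q ∣ + ∣ p ∩ q ∣ ≡⟨ ∣p─q∣+∣p∩q∣≡∣p∣ p q ⟩
  ∣ p ∣                 ∎
  where open ≤-Reasoning

module Covers (G : BipGraph) where

  infixr 7 _∩ᵤ_ _∪ᵤ_

  _∩ᵤ_ _∪ᵤ_ : VSet G → VSet G → VSet G
  (A , B) ∩ᵤ (A' , B') = A ∩ A' , B ∪ B'
  (A , B) ∪ᵤ (A' , B') = A ∪ A' , B ∩ B'

  ∩ᵤ-isVertexCover : ∀ {D C C'} → IsVertexCoverDel G D C → IsVertexCoverDel G D C' →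
                     IsVertexCoverDel G D (C ∩ᵤ C')
  ∩ᵤ-isVertexCover {DU , DV} {A , B} {A' , B'} (A⊆ , B⊆ , cov) (A'⊆ , B'⊆ , cov') =
    A⊆ ∘ p∩q⊆p A A' , [ B⊆ , B'⊆ ] ∘ x∈p∪q⁻ B B' , edge
    where
    edge : ∀ u v → u ∉ DU → v ∉ DV → E G u v ≡ true → u ∈ A ∩ A' ⊎ v ∈ B ∪ B'
    edge u v u∉ v∉ e with cov u v u∉ v∉ e | cov' u v u∉ v∉ e
    ... | inj₂ v∈B | _          = inj₂ (x∈p∪q⁺ (inj₁ v∈B))
    ... | inj₁ _   | inj₂ v∈B'  = inj₂ (x∈p∪q⁺ (inj₂ v∈B'))
    ... | inj₁ u∈A | inj₁ u∈A'  = inj₁ (x∈p∩q⁺ (u∈A , u∈A'))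

  ∪ᵤ-isVertexCover : ∀ {D C C'} → IsVertexCoverDel G D C → IsVertexCoverDel G D C' →
                     IsVertexCoverDel G D (C ∪ᵤ C')
  ∪ᵤ-isVertexCover {DU , DV} {A , B} {A' , B'} (A⊆ , B⊆ , cov) (A'⊆ , B'⊆ , cov') =
    [ A⊆ , A'⊆ ] ∘ x∈p∪q⁻ A A' , B⊆ ∘ p∩q⊆p B B' , edge
    where
    edge : ∀ u v → u ∉ DU → v ∉ DV → E G u v ≡ true → u ∈ A ∪ A' ⊎ v ∈ B ∩ B'
    edge u v u∉ v∉ e with cov u v u∉ v∉ e | cov' u v u∉ v∉ e
    ... | inj₁ u∈A | _          = inj₁ (x∈p∪q⁺ (inj₁ u∈A))
    ... | inj₂ _   | inj₁ u∈A'  = inj₁ (x∈p∪q⁺ (inj₂ u∈A'))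
    ... | inj₂ v∈B | inj₂ v∈B'  = inj₂ (x∈p∩q⁺ (v∈B , v∈B'))

  size-∩ᵤ+size-∪ᵤ : ∀ C C' → size G (C ∩ᵤ C') + size G (C ∪ᵤ C') ≡ size G C + size G C'
  size-∩ᵤ+size-∪ᵤ (A , B) (A' , B') = begin
    (∣ A ∩ A' ∣ + ∣ B ∪ B' ∣) + (∣ A ∪ A' ∣ + ∣ B ∩ B' ∣)
      ≡⟨ interchange (∣ A ∩ A' ∣) (∣ B ∪ B' ∣) (∣ A ∪ A' ∣) (∣ B ∩ B' ∣) ⟩
    (∣ A ∩ A' ∣ + ∣ A ∪ A' ∣) + (∣ B ∪ B' ∣ + ∣ B ∩ B' ∣)
      ≡⟨ cong ((∣ A ∩ A' ∣ + ∣ A ∪ A' ∣) +_) (+-comm (∣ B ∪ B' ∣) (∣ B ∩ B' ∣)) ⟩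
    (∣ A ∩ A' ∣ + ∣ A ∪ A' ∣) + (∣ B ∩ B' ∣ + ∣ B ∪ B' ∣)
      ≡⟨ cong₂ _+_ (∣p∩q∣+∣p∪q∣≡∣p∣+∣q∣ A A') (∣p∩q∣+∣p∪q∣≡∣p∣+∣q∣ B B') ⟩
    (∣ A ∣ + ∣ A' ∣) + (∣ B ∣ + ∣ B' ∣)
      ≡⟨ interchange (∣ A ∣) (∣ A' ∣) (∣ B ∣) (∣ B' ∣) ⟩
    (∣ A ∣ + ∣ B ∣) + (∣ A' ∣ + ∣ B' ∣) ∎
    where open ≡-Reasoning

  minVertexCover-∩ᵤ-≤ : ∀ {D C C'} → IsMinVertexCoverDel G D C → IsVertexCoverDel G D C' →
                        size G (C ∩ᵤ C') ≤ size G C'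
  minVertexCover-∩ᵤ-≤ {C = C} {C'} (cov , min) cov' = +-cancelʳ-≤ (size G (C ∪ᵤ C')) _ _ (begin
    size G (C ∩ᵤ C') + size G (C ∪ᵤ C') ≡⟨ size-∩ᵤ+size-∪ᵤ C C' ⟩
    size G C + size G C'                 ≤⟨ +-monoˡ-≤ (size G C') (min (C ∪ᵤ C') (∪ᵤ-isVertexCover cov cov')) ⟩
    size G (C ∪ᵤ C') + size G C'         ≡⟨ +-comm (size G (C ∪ᵤ C')) (size G C') ⟩
    size G C' + size G (C ∪ᵤ C')         ∎)
    where open ≤-Reasoning

  isVertexCover-restoreV : ∀ {DU DV A B} → IsVertexCoverDel G (DU , DV) (A , B) →
                           IsVertexCoverDel G (DU , ⊥) (A , B ∪ DV)
  isVertexCover-restoreV {DU} {DV} {A} {B} (A⊆ , _ , cov) = A⊆ , (λ _ → x∉p⇒x∈∁p ∉⊥) , edge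
    where
    edge : ∀ u v → u ∉ DU → v ∉ ⊥ → E G u v ≡ true → u ∈ A ⊎ v ∈ B ∪ DV
    edge u v u∉ _ e with v ∈? DV
    ... | yes v∈DV = inj₂ (x∈p∪q⁺ (inj₂ v∈DV))
    ... | no v∉DV  = map₂ (x∈p∪q⁺ ∘ inj₁) (cov u v u∉ v∉DV e)

  isVertexCover-deleteV : ∀ {DU DV A B} → IsVertexCoverDel G (DU , ⊥) (A , B) →
                          IsVertexCoverDel G (DU , DV) (A , B ─ DV)
  isVertexCover-deleteV {DV = DV} {B = B} (A⊆ , _ , cov) =
    A⊆ , x∉p⇒x∈∁p ∘ x∈p─q⇒x∉q B DV ,
    λ u v u∉ v∉ e → map₂ (λ v∈B → x∈p∧x∉q⇒x∈p─q v∈B v∉) (cov u v u∉ ∉⊥ e)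

  size-deleteV-≤ : ∀ {A A' : Subset (m G)} {B B' W : Subset (n G)} → W ⊆ B →
                   size G (A , B) ≤ size G (A' , B' ∪ W) → size G (A , B ─ W) ≤ size G (A' , B')
  size-deleteV-≤ {A} {A'} {B} {B'} {W} W⊆B ≤B'∪W = +-cancelʳ-≤ ∣ W ∣ _ _ (begin
    (∣ A ∣ + ∣ B ─ W ∣) + ∣ W ∣  ≡⟨ +-assoc (∣ A ∣) (∣ B ─ W ∣) (∣ W ∣) ⟩
    ∣ A ∣ + (∣ B ─ W ∣ + ∣ W ∣)  ≤⟨ +-monoʳ-≤ (∣ A ∣) (q⊆p⇒∣p─q∣+∣q∣≤∣p∣ W⊆B) ⟩
    ∣ A ∣ + ∣ B ∣                ≤⟨ ≤B'∪W ⟩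
    ∣ A' ∣ + ∣ B' ∪ W ∣          ≤⟨ +-monoʳ-≤ (∣ A' ∣) (∣p∪q∣≤∣p∣+∣q∣ B' W) ⟩
    ∣ A' ∣ + (∣ B' ∣ + ∣ W ∣)    ≡⟨ +-assoc (∣ A' ∣) (∣ B' ∣) (∣ W ∣) ⟨
    (∣ A' ∣ + ∣ B' ∣) + ∣ W ∣    ∎)
    where open ≤-Reasoning

  isVertexCover? : ∀ D C → Dec (IsVertexCoverDel G D C)
  isVertexCover? (DU , DV) (A , B) =
    A ⊆? ∁ DU ×-dec B ⊆? ∁ DV ×-dec
    all? λ u → all? λ v →
      ¬? (u ∈? DU) →-dec ¬? (v ∈? DV) →-dec (E G u v ≟ᵇ true) →-dec (u ∈? A ⊎-dec v ∈? B)

  remaining-isVertexCover : ∀ DU DV → IsVertexCoverDel G (DU , DV) (∁ DU , ∁ DV)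
  remaining-isVertexCover DU DV = id , id , λ u _ u∉DU _ _ → inj₁ (x∉p⇒x∈∁p u∉DU)

  module _ {P : VSet G → Set} (P? : ∀ C → Dec (P C)) where

    smaller? : ∀ C → Dec (∃ λ C' → P C' × size G C' < size G C)
    smaller? C = map′ (λ (A , B , h) → (A , B) , h) (λ ((A , B) , h) → A , B , h)
      (anySubset? λ A → anySubset? λ B → P? (A , B) ×-dec size G (A , B) <? size G C)

    minimum-below : ∀ k C → size G C ≤ k → P C →
                    Σ (VSet G) λ C → P C × (∀ C' → P C' → size G C ≤ size G C')
    minimum-below zero C ∣C∣≤0 pC = C , pC , λ _ _ → ≤-trans ∣C∣≤0 z≤n
    minimum-below (suc k) C ∣C∣≤1+k pC with smaller? C
    ... | yes (C' , pC' , ∣C'∣<∣C∣) = minimum-below k C' (≤-pred (≤-trans ∣C'∣<∣C∣ ∣C∣≤1+k)) pC'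
    ... | no ∄smaller = C , pC , λ C' pC' → ≮⇒≥ (λ ∣C'∣<∣C∣ → ∄smaller (C' , pC' , ∣C'∣<∣C∣))

  minVertexCover-exists : ∀ D → Σ (VSet G) (IsMinVertexCoverDel G D)
  minVertexCover-exists (DU , DV) =
    minimum-below (isVertexCover? (DU , DV)) _ (∁ DU , ∁ DV) ≤-refl (remaining-isVertexCover DU DV)

lemma5 : (G : BipGraph) (X Y : Subset (n G))
    → Σ (VSet G) (λ C → IsMinVertexCover G C × X ⊆ proj₂ C)
    → Σ (VSet G) (λ C → IsMinVertexCoverMinusV G Y C × (X ─ Y) ⊆ proj₂ C)
lemma5 G X Y ((A , B) , minC , X⊆B) with Covers.minVertexCover-exists G (⊥ , Y)
... | (A' , B') , covD , minD = K , (covK , minK) , X─Y⊆K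
  where
  open Covers G

  J : VSet G
  J = (A , B) ∩ᵤ (A' , B' ∪ Y)

  covD∪Y : IsVertexCoverDel G (⊥ , ⊥) (A' , B' ∪ Y)
  covD∪Y = isVertexCover-restoreV covD

  covJ : IsVertexCoverDel G (⊥ , ⊥) J
  covJ = ∩ᵤ-isVertexCover (proj₁ minC) covD∪Y

  K : VSet G
  K = A ∩ A' , (B ∪ (B' ∪ Y)) ─ Y

  covK : IsVertexCoverDel G (⊥ , Y) K
  covK = isVertexCover-deleteV covJ

  minK : ∀ C' → IsVertexCoverDel G (⊥ , Y) C' → size G K ≤ size G C'
  minK C' covC' = ≤-trans
    (size-deleteV-≤ {A ∩ A'} {A'} {B' = B'} (q⊆p∪q B (B' ∪ Y) ∘ q⊆p∪q B' Y)
                    (minVertexCover-∩ᵤ-≤ minC covD∪Y))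
    (minD C' covC')

  X─Y⊆K : X ─ Y ⊆ proj₂ K
  X─Y⊆K x∈X─Y = x∈p∧x∉q⇒x∈p─q (p⊆p∪q (B' ∪ Y) (X⊆B (p─q⊆p X Y x∈X─Y))) (x∈p─q⇒x∉q X Y x∈X─Y)
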